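{- Let $G$ be a graph without isolated vertices. (i) If $f=(V_0,V_1,V_2)$ is any $\gamma_R(G)$-function, then $\gamma_{qtR}(G)\le \gamma_R(G)+|V_2|$. (ii) If $f'=(V'_0,V'_1,V'_2)$ is any $\gamma_{qtR}(G)$-function, then $\gamma_{tR}(G)\le \gamma_{qtR}(G)+|V'_1|$.
   Context: All graphs are finite, simple and undirected. For a function $f:V(G)\to\{0,1,2\}$ write $V_i=\{v: f(v)=i\}$ and $f=(V_0,V_1,V_2)$; its weight is $\omega(f)=\sum_{v}f(v)=|V_1|+2|V_2|$. A Roman dominating function (RDF) is such an $f$ in which every vertex with label $0$ has a neighbor with label $2$; $\gamma_R(G)$ is the minimum weight of an RDF, and a $\gamma_R(G)$-function is an RDF of that weight. A total Roman dominating function (TRDF) on a graph with no isolated vertex is an RDF such that the subgraph induced by $\{v: f(v)\neq 0\}$ has no isolated vertices; $\gamma_{tR}(G)$ is its minimum weight. A quasi-total Roman dominating function (QTRDF) is a function $f:V(G)\to\{0,1,2\}$ such that every vertex $u$ with $f(u)=0$ is adjacent to some vertex $v$ with $f(v)=2$, and every vertex $x$ that is isolated in the subgraph induced by $V_1\cup V_2$ satisfies $f(x)=1$. $\gamma_{qtR}(G)$ is the minimum weight of a QTRDF on $G$, and a $\gamma_{qtR}(G)$-function is a QTRDF of weight $\gamma_{qtR}(G)$. -}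

module Defs where

open import Data.Nat using (ℕ; zero; suc; _+_; _*_; _≤_)
open import Data.Fin using (Fin)
open import Data.List using (List; map; filter; length)
open import Data.Nat.ListAction using (sum)
open import Data.List.Base using (allFin)
open import Data.Bool using (Bool; true; false; T; _≟_)
open import Data.Product using (Σ; ∃; ∃-syntax; _×_; _,_)
open import Data.Sum using (_⊎_)
open import Relation.Binary.PropositionalEquality using (_≡_)
open import Relation.Nullary using (¬_)
open import Relation.Nullary.Decidable using (Dec; yes; no)

record Graph : Set where
  field
    n     : ℕ
    adj   : Fin n → Fin n → Bool
    sym   : ∀ u v → adj u v ≡ adj v u
    irrefl : ∀ v → adj v v ≡ false

open Graph public

Vertex : Graph → Set
Vertex G = Fin (n G)

Adj : (G : Graph) → Vertex G → Vertex G → Set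
Adj G u v = T (adj G u v)

NoIsolated : Graph → Set
NoIsolated G = ∀ v → ∃[ u ] Adj G v u

data Label : Set where
  l0 l1 l2 : Label

val : Label → ℕ
val l0 = 0
val l1 = 1
val l2 = 2

Labeling : Graph → Set
Labeling G = Vertex G → Label

weight : (G : Graph) → Labeling G → ℕ
weight G f = sum (map (λ v → val (f v)) (allFin (n G)))

is1 : Label → Bool
is1 l1 = true
is1 _  = false

is2 : Label → Bool
is2 l2 = true
is2 _  = false

card1 : (G : Graph) → Labeling G → ℕ
card1 G f = length (filter (λ v → _≟_ (is1 (f v)) true) (allFin (n G)))

card2 : (G : Graph) → Labeling G → ℕ
card2 G f = length (filter (λ v → _≟_ (is2 (f v)) true) (allFin (n G)))

IsRDF : (G : Graph) → Labeling G → Set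
IsRDF G f = ∀ u → f u ≡ l0 → ∃[ v ] (Adj G u v × f v ≡ l2)

IsolatedInPositive : (G : Graph) → Labeling G → Vertex G → Set
IsolatedInPositive G f x =
  ¬ (f x ≡ l0) × (∀ y → Adj G x y → f y ≡ l0)

IsTRDF : (G : Graph) → Labeling G → Set
IsTRDF G f = IsRDF G f × (∀ x → ¬ IsolatedInPositive G f x)

IsQTRDF : (G : Graph) → Labeling G → Set
IsQTRDF G f = IsRDF G f × (∀ x → IsolatedInPositive G f x → f x ≡ l1)

IsMinimum : (G : Graph) → (Labeling G → Set) → Labeling G → Set
IsMinimum G P f = P f × (∀ g → P g → weight G f ≤ weight G g)

-- Every vertex in a chosen set B (B = V₂ in (i), B = V₁ in (ii)) picks a
-- neighbour, which exists because G has no isolated vertex, and every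
-- picked vertex labelled 0 is relabelled 1.  This costs at most |B|, keeps
-- the Roman domination condition, and gives each vertex of B a positive
-- neighbour.  In (i) the vertices of V₂ are then no longer isolated in
-- G[V₁ ∪ V₂], which makes the function quasi-total.  In (ii) a vertex
-- labelled 1 by f' is no longer isolated, a relabelled vertex sees the
-- vertex of V'₁ that picked it, and a vertex of V'₂ with no positive
-- neighbour would already be isolated under f', which quasi-totality
-- forbids; so the function is total.
module Submission where

open import Defs hiding (sym)
open import Data.Nat using (_≤_; _+_)
open import Data.Product using (_×_)

open import Data.Bool using (Bool; true; false; T; _∧_)
import Data.Bool as Bool
open import Data.Empty using (⊥; ⊥-elim)
open import Data.Fin using (Fin; zero; suc; _≟_)
open import Data.List using (List; []; _∷_; map; filter; length; tabulate; allFin)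
open import Data.List.Properties using (map-tabulate)
import Data.Nat.ListAction as List
open import Data.Nat using (ℕ; zero; suc; _<_; z≤n; s≤s)
open import Data.Nat.Properties using (+-0-commutativeMonoid; +-mono-≤; ≤-trans; m≤m+n; m≤n+m; module ≤-Reasoning)
open import Data.Product using (∃-syntax; _,_; proj₁; proj₂)
open import Function using (_∘_; id)
open import Relation.Binary.PropositionalEquality using (_≡_; _≢_; refl; sym; trans; cong; cong₂; subst; module ≡-Reasoning)
open import Relation.Nullary using (¬_; yes; no; does)
open import Relation.Nullary.Decidable using (dec-true)

open import Algebra.Properties.CommutativeMonoid.Sum +-0-commutativeMonoid
  using (sum-syntax; sum-cong-≗; sum-replicate-zero; ∑-comm; ∑-distrib-+)

boolToℕ : Bool → ℕ
boolToℕ true  = 1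
boolToℕ false = 0

∑-mono-≤ : ∀ {n} {f g : Fin n → ℕ} → (∀ i → f i ≤ g i) → ∑[ i < n ] f i ≤ ∑[ i < n ] g i
∑-mono-≤ {zero}  f≤g = z≤n
∑-mono-≤ {suc n} f≤g = +-mono-≤ (f≤g zero) (∑-mono-≤ (f≤g ∘ suc))

≤-∑ : ∀ {n} (f : Fin n → ℕ) i → f i ≤ ∑[ j < n ] f j
≤-∑ f zero    = m≤m+n (f zero) _
≤-∑ f (suc i) = ≤-trans (≤-∑ (f ∘ suc) i) (m≤n+m _ (f zero))

∑-positive⇒∃-positive : ∀ {n} (f : Fin n → ℕ) → 0 < ∑[ i < n ] f i → ∃[ i ] 0 < f i
∑-positive⇒∃-positive {suc n} f ∑>0 with f zero in f₀
... | suc _ = zero , subst (0 <_) (sym f₀) (s≤s z≤n)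
... | zero  with i , fᵢ>0 ← ∑-positive⇒∃-positive (f ∘ suc) ∑>0 = suc i , fᵢ>0

∑-indicator : ∀ {n} (u : Fin n) → ∑[ y < n ] boolToℕ (does (u ≟ y)) ≡ 1
∑-indicator {suc n} zero    = cong suc (sum-replicate-zero n)
∑-indicator {suc n} (suc u) = ∑-indicator u

∑-masked-indicator : ∀ {n} b (u : Fin n) → ∑[ y < n ] boolToℕ (b ∧ does (u ≟ y)) ≡ boolToℕ b
∑-masked-indicator {n} false u = sum-replicate-zero n
∑-masked-indicator     true  u = ∑-indicator u

sum-tabulate : ∀ {n} (f : Fin n → ℕ) → List.sum (tabulate f) ≡ ∑[ i < n ] f i
sum-tabulate {zero}  f = refl
sum-tabulate {suc n} f = cong (f zero +_) (sum-tabulate (f ∘ suc))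

length-filter≡sum : ∀ {A : Set} (p : A → Bool) (xs : List A) →
  length (filter (λ x → p x Bool.≟ true) xs) ≡ List.sum (map (boolToℕ ∘ p) xs)
length-filter≡sum p []       = refl
length-filter≡sum p (x ∷ xs) with p x
... | true  = cong suc (length-filter≡sum p xs)
... | false = length-filter≡sum p xs

∑-map-allFin : ∀ {n} (f : Fin n → ℕ) → List.sum (map f (allFin n)) ≡ ∑[ i < n ] f i
∑-map-allFin f = trans (cong List.sum (map-tabulate id f)) (sum-tabulate f)

weight≡∑ : ∀ G (f : Labeling G) → weight G f ≡ ∑[ v < n G ] val (f v)
weight≡∑ G f = ∑-map-allFin (val ∘ f)

count≡∑ : ∀ {n} (p : Fin n → Bool) →
  length (filter (λ v → p v Bool.≟ true) (allFin n)) ≡ ∑[ v < n ] boolToℕ (p v)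
count≡∑ {n} p = trans (length-filter≡sum p (allFin n)) (∑-map-allFin (boolToℕ ∘ p))

module Charge {m n : ℕ} (chosen : Fin m → Bool) (target : Fin m → Fin n) where

  charge : Fin n → ℕ
  charge y = ∑[ v < m ] boolToℕ (chosen v ∧ does (target v ≟ y))

  ∑-charge : ∑[ y < n ] charge y ≡ ∑[ v < m ] boolToℕ (chosen v)
  ∑-charge = begin
    ∑[ y < n ] ∑[ v < m ] boolToℕ (chosen v ∧ does (target v ≟ y))
      ≡⟨ sym (∑-comm (λ v y → boolToℕ (chosen v ∧ does (target v ≟ y)))) ⟩
    ∑[ v < m ] ∑[ y < n ] boolToℕ (chosen v ∧ does (target v ≟ y))
      ≡⟨ sum-cong-≗ (λ v → ∑-masked-indicator (chosen v) (target v)) ⟩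
    ∑[ v < m ] boolToℕ (chosen v) ∎
    where open ≡-Reasoning

  chosen⇒target-charged : ∀ v → chosen v ≡ true → 0 < charge (target v)
  chosen⇒target-charged v chosen-v = subst (λ k → k ≤ charge (target v)) unit (≤-∑ _ v)
    where
      unit : boolToℕ (chosen v ∧ does (target v ≟ target v)) ≡ 1
      unit rewrite chosen-v | dec-true (target v ≟ target v) refl = refl

  charged⇒∃chosen : ∀ y → 0 < charge y → ∃[ v ] (chosen v ≡ true × target v ≡ y)
  charged⇒∃chosen y charged
    with v , positive ← ∑-positive⇒∃-positive _ charged
    with chosen v in chosen-v | target v ≟ y
  ... | true  | yes tv≡y = v , chosen-v , tv≡y
  ... | true  | no _     with () ← positive
  ... | false | _        with () ← positive

raise : Label → ℕ → Label
raise l0 zero    = l0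
raise l0 (suc _) = l1
raise l1 _       = l1
raise l2 _       = l2

val-raise : ∀ l k → val (raise l k) ≤ val l + k
val-raise l0 zero    = z≤n
val-raise l0 (suc k) = s≤s z≤n
val-raise l1 k       = s≤s z≤n
val-raise l2 k       = s≤s (s≤s z≤n)

raise-nonzero : ∀ {l} k → l ≢ l0 → raise l k ≡ l
raise-nonzero {l0} k l≢0 = ⊥-elim (l≢0 refl)
raise-nonzero {l1} k l≢0 = refl
raise-nonzero {l2} k l≢0 = refl

raise≡l0⇒≡l0 : ∀ l k → raise l k ≡ l0 → l ≡ l0
raise≡l0⇒≡l0 l0 k _ = refl

raise-charged≢l0 : ∀ l {k} → 0 < k → raise l k ≢ l0
raise-charged≢l0 l0 {suc k} _ ()

raise-l0 : ∀ {l} k → l ≡ l0 → raise l k ≢ l0 → raise l k ≡ l1 × 0 < k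
raise-l0 zero    refl raised≢0 = ⊥-elim (raised≢0 refl)
raise-l0 (suc k) refl raised≢0 = refl , s≤s z≤n

Adj-sym : ∀ G {u v} → Adj G u v → Adj G v u
Adj-sym G {u} {v} = subst T (Graph.sym G u v)

module Raise (G : Graph) (noIsolated : NoIsolated G) (f : Labeling G)
             (chosen : Vertex G → Bool) where

  picked : Vertex G → Vertex G
  picked v = proj₁ (noIsolated v)

  open Charge chosen picked

  raised : Labeling G
  raised x = raise (f x) (charge x)

  weight-raised :
    weight G raised ≤ weight G f + length (filter (λ v → chosen v Bool.≟ true) (allFin (n G)))
  weight-raised = begin
    weight G raised                                 ≡⟨ weight≡∑ G raised ⟩
    ∑[ x < n G ] val (raise (f x) (charge x))       ≤⟨ ∑-mono-≤ (λ x → val-raise (f x) (charge x)) ⟩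
    ∑[ x < n G ] (val (f x) + charge x)             ≡⟨ ∑-distrib-+ (val ∘ f) charge ⟩
    ∑[ x < n G ] val (f x) + ∑[ x < n G ] charge x  ≡⟨ cong₂ _+_ (sym (weight≡∑ G f)) ∑-charge ⟩
    weight G f + ∑[ v < n G ] boolToℕ (chosen v)    ≡⟨ cong (weight G f +_) (sym (count≡∑ chosen)) ⟩
    weight G f + length (filter (λ v → chosen v Bool.≟ true) (allFin (n G))) ∎
    where open ≤-Reasoning

  raised-nonzero : ∀ x → f x ≢ l0 → raised x ≡ f x
  raised-nonzero x = raise-nonzero (charge x)

  raised≡l0⇒≡l0 : ∀ x → raised x ≡ l0 → f x ≡ l0
  raised≡l0⇒≡l0 x = raise≡l0⇒≡l0 (f x) (charge x)

  picked-raised≢l0 : ∀ v → chosen v ≡ true → raised (picked v) ≢ l0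
  picked-raised≢l0 v chosen-v = raise-charged≢l0 (f (picked v)) (chosen⇒target-charged v chosen-v)

  newly-raised≡l1 : ∀ x → f x ≡ l0 → raised x ≢ l0 → raised x ≡ l1
  newly-raised≡l1 x fx≡0 raised≢0 = proj₁ (raise-l0 (charge x) fx≡0 raised≢0)

  newly-raised⇒chosen-neighbour : ∀ x → f x ≡ l0 → raised x ≢ l0 →
    ∃[ v ] (chosen v ≡ true × Adj G x v)
  newly-raised⇒chosen-neighbour x fx≡0 raised≢0
    with v , chosen-v , refl ← charged⇒∃chosen x (proj₂ (raise-l0 (charge x) fx≡0 raised≢0))
    = v , chosen-v , Adj-sym G (proj₂ (noIsolated v))

  isolated-raised⇒isolated : ∀ x → f x ≢ l0 → (∀ y → Adj G x y → raised y ≡ l0) →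
    IsolatedInPositive G f x
  isolated-raised⇒isolated x fx≢0 isolated = fx≢0 , λ y x~y → raised≡l0⇒≡l0 y (isolated y x~y)

  raised-isRDF : IsRDF G f → IsRDF G raised
  raised-isRDF f-rdf u raised-u≡0
    with v , u~v , fv≡2 ← f-rdf u (raised≡l0⇒≡l0 u raised-u≡0)
    = v , u~v , trans (raised-nonzero v (subst (_≢ l0) (sym fv≡2) λ ())) fv≡2

qtrdf-from-rdf : ∀ G → NoIsolated G → (f : Labeling G) → IsRDF G f →
  ∃[ g ] (IsQTRDF G g × weight G g ≤ weight G f + card2 G f)
qtrdf-from-rdf G noIsolated f f-rdf = raised , (raised-isRDF f-rdf , quasi-total) , weight-raised
  where
    open Raise G noIsolated f (is2 ∘ f)

    quasi-total : ∀ x → IsolatedInPositive G raised x → raised x ≡ l1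
    quasi-total x (raised≢0 , isolated) = by-label (f x) refl
      where
        by-label : ∀ l → f x ≡ l → raised x ≡ l1
        by-label l0 fx = newly-raised≡l1 x fx raised≢0
        by-label l1 fx = trans (raised-nonzero x (subst (_≢ l0) (sym fx) λ ())) fx
        by-label l2 fx = ⊥-elim (picked-raised≢l0 x (cong is2 fx) (isolated (picked x) (proj₂ (noIsolated x))))

is1⇒≢l0 : ∀ {l} → is1 l ≡ true → l ≢ l0
is1⇒≢l0 {l1} _ ()

trdf-from-qtrdf : ∀ G → NoIsolated G → (f : Labeling G) → IsQTRDF G f →
  ∃[ g ] (IsTRDF G g × weight G g ≤ weight G f + card1 G f)
trdf-from-qtrdf G noIsolated f (f-rdf , f-quasi-total) =
  raised , (raised-isRDF f-rdf , total) , weight-raised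
  where
    open Raise G noIsolated f (is1 ∘ f)

    total : ∀ x → ¬ IsolatedInPositive G raised x
    total x (raised≢0 , isolated) = by-label (f x) refl
      where
        by-label : ∀ l → f x ≡ l → ⊥
        by-label l0 fx with v , chosen-v , x~v ← newly-raised⇒chosen-neighbour x fx raised≢0
          = is1⇒≢l0 chosen-v (raised≡l0⇒≡l0 v (isolated v x~v))
        by-label l1 fx = picked-raised≢l0 x (cong is1 fx) (isolated (picked x) (proj₂ (noIsolated x)))
        by-label l2 fx
          with () ← trans (sym fx)
                      (f-quasi-total x (isolated-raised⇒isolated x (subst (_≢ l0) (sym fx) λ ()) isolated))

weight-minimum-≤ : ∀ G {P : Labeling G → Set} {h : Labeling G} {w : ℕ} →
  IsMinimum G P h → ∃[ g ] (P g × weight G g ≤ w) → weight G h ≤ w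
weight-minimum-≤ G (_ , minimal) (g , Pg , g≤w) = ≤-trans (minimal g Pg) g≤w

mainTheorem1 : (G : Graph) → NoIsolated G →
    ((f h : Labeling G) → IsMinimum G (IsRDF G) f → IsMinimum G (IsQTRDF G) h →
      weight G h ≤ weight G f + card2 G f)
    ×
    ((f' t : Labeling G) → IsMinimum G (IsQTRDF G) f' → IsMinimum G (IsTRDF G) t →
      weight G t ≤ weight G f' + card1 G f')
mainTheorem1 G noIsolated =
    (λ f h (f-rdf , _) h-min → weight-minimum-≤ G h-min (qtrdf-from-rdf G noIsolated f f-rdf))
  , (λ f' t (f'-qtrdf , _) t-min → weight-minimum-≤ G t-min (trdf-from-qtrdf G noIsolated f' f'-qtrdf))
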